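{- Define recursively $(a_0,b_0)=(2,4)$ and, for all $n\ge 1$, $a_n=\mathrm{mex}(\{a_i,b_i: i<n\}\cup\{0,1\})$ and $b_n=a_n+n+2$. Then the set of non-terminal $\mathcal{P}$-positions of $K^1$ is $\{(a_n,b_n): n\ge 0\}\cup\{(b_n,a_n): n\ge 0\}$.
   Context: $\mathrm{mex}\,S=\min(\mathbb{N}\setminus S)$. Positions are pairs $(x,y)\in\mathbb{N}^2$. A Wythoff move from $(x,y)$ leads to $(x-i,y)$ with $1\le i\le x$, to $(x,y-i)$ with $1\le i\le y$, or to $(x-i,y-i)$ with $1\le i\le\min(x,y)$. For $\ell\in\mathbb{N}$, $K^\ell$ is the two-player impartial game with Wythoff moves in which the positions of $\{(x,y): x+y\le\ell\}$ are terminal: no move is allowed from a terminal position, and a player who moves into a terminal position wins (normal play). A $\mathcal{P}$-position is a position from which the previous player has a winning strategy. -}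

module Defs where

open import Data.Nat using (ℕ; _+_; _∸_; _≤_; _<_; _⊔_; _⊓_)
open import Data.Product using (_×_; _,_; ∃-syntax)
open import Data.Sum using (_⊎_)
open import Relation.Nullary using (¬_)
open import Relation.Binary.PropositionalEquality using (_≡_)

Pos : Set
Pos = ℕ × ℕ

IsMex : (ℕ → Set) → ℕ → Set
IsMex S m = ¬ S m × (∀ k → k < m → S k)

data WMove : Pos → Pos → Set where
  left  : ∀ {x y} i → 1 ≤ i → i ≤ x → WMove (x , y) (x ∸ i , y)
  down  : ∀ {x y} i → 1 ≤ i → i ≤ y → WMove (x , y) (x , y ∸ i)
  diag  : ∀ {x y} i → 1 ≤ i → i ≤ x ⊓ y → WMove (x , y) (x ∸ i , y ∸ i)

Terminal : ℕ → Pos → Set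
Terminal ℓ (x , y) = x + y ≤ ℓ

Move : ℕ → Pos → Pos → Set
Move ℓ p q = ¬ Terminal ℓ p × WMove p q

-- P- and N-positions of K^ℓ under normal play (the game is finite,
-- so the inductive definitions give the usual outcome classes)
mutual
  data IsP (ℓ : ℕ) (p : Pos) : Set where
    isP : (∀ q → Move ℓ p q → IsN ℓ q) → IsP ℓ p

  data IsN (ℓ : ℕ) (p : Pos) : Set where
    isN : ∀ q → Move ℓ p q → IsP ℓ q → IsN ℓ p

IsSeq : (ℕ → ℕ) → (ℕ → ℕ) → Set
IsSeq a b =
  a 0 ≡ 2 × b 0 ≡ 4 ×
  (∀ n → 1 ≤ n →
     IsMex (λ k → (∃[ i ] (i < n × (k ≡ a i ⊎ k ≡ b i))) ⊎ k ≡ 0 ⊎ k ≡ 1) (a n)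
     × b n ≡ a n + n + 2)

{-# OPTIONS --safe #-}
module Submission where

-- The P-positions of a finite game form its kernel: the unique set K such that no move
-- leads from K into K and every position outside K has a move into K.  So it suffices to
-- check these two properties for K = the terminal positions together with the pairs
-- (a n, b n) and (b n, a n).  No move joins two pairs, since every k ≥ 2 is exactly one
-- of the a's and b's, and the pair with index n is the only one with difference
-- b n ∸ a n = n + 2; no move from a pair reaches x + y ≤ 1 either.  Conversely, by
-- symmetry take a non-terminal (x, x + d) outside K.  If d ≤ 1 or x ≤ 1 some move reaches
-- a terminal position.  Otherwise x is some a n or b n: from x = b n move down to
-- (b n, a n), and from x = a n with d = m + 2 move down to (a n, b n) if m > n, or
-- diagonally to (a m, b m) if m < n.

open import Defs
open import Data.Nat using (ℕ; zero; suc; _<_; _+_; _≤_; z≤n; s≤s; z<s; _≤?_)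
open import Data.Nat.Induction using (<-wellFounded)
open import Data.Nat.Properties
open import Algebra.Properties.CommutativeSemigroup +-commutativeSemigroup using (xy∙z≈xz∙y)
open import Data.Product using (_×_; _,_; ∃-syntax; proj₁; proj₂; swap)
open import Data.Sum using (_⊎_; inj₁; inj₂; [_,_]′)
import Data.Sum as Sum
open import Function using (_∘_; id)
open import Function.Bundles using (_⇔_; mk⇔)
open import Induction.WellFounded using (Acc; acc)
open import Relation.Binary using (Monotonic₁; tri<; tri≈; tri>)
open import Relation.Binary.PropositionalEquality
  using (_≡_; _≢_; refl; sym; trans; cong; subst; subst₂; module ≡-Reasoning)
open import Relation.Nullary using (¬_; yes; no; contradiction)

<⇒∃+suc : ∀ {m n} → m < n → ∃[ k ] (n ≡ m + suc k)
<⇒∃+suc {m} m<n with m≤n⇒∃[o]m+o≡n m<n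
... | k , refl = k , sym (+-suc m k)

diagonal-gap : ∀ {x y u v} k d → x ≡ u + k → y ≡ v + k → y ≡ x + d → v ≡ u + d
diagonal-gap {x} {y} {u} {v} k d x≡u+k y≡v+k y≡x+d = +-cancelʳ-≡ k v (u + d) (begin
  v + k      ≡⟨ sym y≡v+k ⟩
  y          ≡⟨ y≡x+d ⟩
  x + d      ≡⟨ cong (_+ d) x≡u+k ⟩
  u + k + d  ≡⟨ xy∙z≈xz∙y u k d ⟩
  u + d + k  ∎)
  where open ≡-Reasoning

step⇒strictMono : ∀ {f : ℕ → ℕ} → (∀ n → f n < f (suc n)) → Monotonic₁ _<_ _<_ f
step⇒strictMono f-step {m} {suc n} m<1+n with m<1+n⇒m<n∨m≡n m<1+n
... | inj₁ m<n  = <-trans (step⇒strictMono f-step m<n) (f-step n)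
... | inj₂ refl = f-step m

step⇒f0+n≤fn : ∀ {f : ℕ → ℕ} → (∀ n → f n < f (suc n)) → ∀ n → f 0 + n ≤ f n
step⇒f0+n≤fn {f} f-step zero = ≤-reflexive (+-identityʳ (f 0))
step⇒f0+n≤fn {f} f-step (suc n) =
  subst (_≤ f (suc n)) (sym (+-suc (f 0) n)) (≤-<-trans (step⇒f0+n≤fn f-step n) (f-step n))

strictMono⇒injective : ∀ {f : ℕ → ℕ} → Monotonic₁ _<_ _<_ f → ∀ {m n} → f m ≡ f n → m ≡ n
strictMono⇒injective f-mono {m} {n} fm≡fn with <-cmp m n
... | tri< m<n _ _ = contradiction fm≡fn (<⇒≢ (f-mono m<n))
... | tri≈ _ m≡n _ = m≡n
... | tri> _ _ n<m = contradiction (sym fm≡fn) (<⇒≢ (f-mono n<m))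

IsMex-mono : ∀ {S T : ℕ → Set} {m n} → (∀ {k} → S k → T k) → IsMex S m → IsMex T n → m ≤ n
IsMex-mono S⊆T (_ , S-below-m) (n∉T , _) = ≮⇒≥ (λ n<m → n∉T (S⊆T (S-below-m _ n<m)))

IsMex-0-1 : IsMex (λ k → k ≡ 0 ⊎ k ≡ 1) 2
IsMex-0-1 = (λ { (inj₁ ()) ; (inj₂ ()) }) , λ where
  0 _ → inj₁ refl
  1 _ → inj₂ refl
  (suc (suc _)) (s≤s (s≤s ()))

IsP⇒¬IsN : ∀ {ℓ p} → IsP ℓ p → ¬ IsN ℓ p
IsP⇒¬IsN (isP reply) (isN q p→q q-isP) = IsP⇒¬IsN q-isP (reply q p→q)

Terminal-swap : ∀ {ℓ} p → Terminal ℓ p → Terminal ℓ (swap p)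
Terminal-swap {ℓ} (x , y) = subst (_≤ ℓ) (+-comm x y)

<⇒¬Terminal : ∀ {ℓ y} x → ℓ < y → ¬ Terminal ℓ (x , y)
<⇒¬Terminal {y = y} x ℓ<y = <⇒≱ (<-≤-trans ℓ<y (m≤n+m y x))

data WStep : Pos → Pos → Set where
  left : ∀ {x y u} i → x ≡ u + suc i → WStep (x , y) (u , y)
  down : ∀ {x y v} i → y ≡ v + suc i → WStep (x , y) (x , v)
  diag : ∀ {x y u v} i → x ≡ u + suc i → y ≡ v + suc i → WStep (x , y) (u , v)

WMove⇒WStep : ∀ {p q} → WMove p q → WStep p q
WMove⇒WStep (left zero () _)
WMove⇒WStep (down zero () _)
WMove⇒WStep (diag zero () _)
WMove⇒WStep (left (suc i) _ i≤x) = left i (sym (m∸n+n≡m i≤x))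
WMove⇒WStep (down (suc i) _ i≤y) = down i (sym (m∸n+n≡m i≤y))
WMove⇒WStep {x , y} (diag (suc i) _ i≤x⊓y) =
  diag i (sym (m∸n+n≡m (≤-trans i≤x⊓y (m⊓n≤m x y))))
         (sym (m∸n+n≡m (≤-trans i≤x⊓y (m⊓n≤n x y))))

WStep⇒WMove : ∀ {p q} → WStep p q → WMove p q
WStep⇒WMove (left {y = y} {u} i refl) =
  subst (λ w → WMove (u + suc i , y) (w , y)) (m+n∸n≡m u (suc i))
    (left (suc i) (s≤s z≤n) (m≤n+m (suc i) u))
WStep⇒WMove (down {x} {v = v} i refl) =
  subst (λ w → WMove (x , v + suc i) (x , w)) (m+n∸n≡m v (suc i))
    (down (suc i) (s≤s z≤n) (m≤n+m (suc i) v))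
WStep⇒WMove (diag {u = u} {v} i refl refl) =
  subst₂ (λ w z → WMove (u + suc i , v + suc i) (w , z)) (m+n∸n≡m u (suc i)) (m+n∸n≡m v (suc i))
    (diag (suc i) (s≤s z≤n) (⊓-glb (m≤n+m (suc i) u) (m≤n+m (suc i) v)))

WStep-swap : ∀ {p q} → WStep p q → WStep (swap p) (swap q)
WStep-swap (left i e)     = down i e
WStep-swap (down i e)     = left i e
WStep-swap (diag i e₁ e₂) = diag i e₂ e₁

down< : ∀ {x y v} → v < y → WStep (x , y) (x , v)
down< v<y = let i , y≡v+i = <⇒∃+suc v<y in down i y≡v+i

size : Pos → ℕ
size (x , y) = x + y

WStep-size : ∀ {p q} → WStep p q → size q < size p
WStep-size (left {y = y} {u} i refl)      = +-monoˡ-< y (m<m+n u z<s)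
WStep-size (down {x} {v = v} i refl)      = +-monoʳ-< x (m<m+n v z<s)
WStep-size (diag {u = u} {v} i refl refl) = +-mono-< (m<m+n u z<s) (m<m+n v z<s)

Move-size : ∀ {ℓ p q} → Move ℓ p q → size q < size p
Move-size = WStep-size ∘ WMove⇒WStep ∘ proj₂

module _ {ℓ : ℕ} {K : Pos → Set}
         (stable : ∀ {p q} → K p → Move ℓ p q → ¬ K q)
         (absorbing : ∀ p → K p ⊎ ∃[ q ] (Move ℓ p q × K q)) where

  kernel⇒IsP-acc : ∀ {p} → Acc _<_ (size p) → K p → IsP ℓ p
  kernel⇒IsP-acc {p} (acc smaller) kp = isP reply
    where
    reply : ∀ q → Move ℓ p q → IsN ℓ q
    reply q p→q with absorbing q
    ... | inj₁ kq = contradiction kq (stable kp p→q)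
    ... | inj₂ (r , q→r , kr) =
      isN r q→r (kernel⇒IsP-acc (smaller (<-trans (Move-size q→r) (Move-size p→q))) kr)

  kernel⇒IsP : ∀ {p} → K p → IsP ℓ p
  kernel⇒IsP = kernel⇒IsP-acc (<-wellFounded _)

  IsP⇒kernel : ∀ {p} → IsP ℓ p → K p
  IsP⇒kernel {p} isp with absorbing p
  ... | inj₁ kp = kp
  ... | inj₂ (q , p→q , kq) = contradiction (isN q p→q (kernel⇒IsP kq)) (IsP⇒¬IsN isp)

module Sequence {a b : ℕ → ℕ} (seq : IsSeq a b) where

  Excluded : ℕ → ℕ → Set
  Excluded n k = (∃[ i ] (i < n × (k ≡ a i ⊎ k ≡ b i))) ⊎ k ≡ 0 ⊎ k ≡ 1

  Excluded-mono : ∀ {m n k} → m ≤ n → Excluded m k → Excluded n k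
  Excluded-mono m≤n (inj₁ (i , i<m , e)) = inj₁ (i , <-≤-trans i<m m≤n , e)
  Excluded-mono _   (inj₂ e)             = inj₂ e

  a-mex : ∀ n → IsMex (Excluded (suc n)) (a (suc n))
  a-mex n = proj₁ (proj₂ (proj₂ seq) (suc n) (s≤s z≤n))

  b≡a+2+n : ∀ n → b n ≡ a n + (2 + n)
  b≡a+2+n zero rewrite proj₁ seq | proj₁ (proj₂ seq) = refl
  b≡a+2+n (suc n) = begin
    b (suc n)                 ≡⟨ proj₂ (proj₂ (proj₂ seq) (suc n) (s≤s z≤n)) ⟩
    a (suc n) + suc n + 2     ≡⟨ +-assoc (a (suc n)) (suc n) 2 ⟩
    a (suc n) + (suc n + 2)   ≡⟨ cong (a (suc n) +_) (+-comm (suc n) 2) ⟩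
    a (suc n) + (2 + suc n)   ∎
    where open ≡-Reasoning

  2≤a : ∀ n → 2 ≤ a n
  2≤a zero    = ≤-reflexive (sym (proj₁ seq))
  2≤a (suc n) = IsMex-mono inj₂ IsMex-0-1 (a-mex n)

  a-step : ∀ n → a n < a (suc n)
  a-step n = ≤∧≢⇒< (a≤a-suc n) (λ e → proj₁ (a-mex n) (inj₁ (n , ≤-refl , inj₁ (sym e))))
    where
    a≤a-suc : ∀ n → a n ≤ a (suc n)
    a≤a-suc zero    = subst (_≤ a 1) (sym (proj₁ seq)) (2≤a 1)
    a≤a-suc (suc n) = IsMex-mono (Excluded-mono (n≤1+n _)) (a-mex n) (a-mex (suc n))

  a-strictMono : Monotonic₁ _<_ _<_ a
  a-strictMono = step⇒strictMono a-step

  b-strictMono : Monotonic₁ _<_ _<_ b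
  b-strictMono {m} {n} m<n = subst₂ _<_ (sym (b≡a+2+n m)) (sym (b≡a+2+n n))
    (+-mono-< (a-strictMono m<n) (+-monoʳ-< 2 m<n))

  a-injective : ∀ {m n} → a m ≡ a n → m ≡ n
  a-injective = strictMono⇒injective a-strictMono

  b-injective : ∀ {m n} → b m ≡ b n → m ≡ n
  b-injective = strictMono⇒injective b-strictMono

  a<b : ∀ n → a n < b n
  a<b n = subst (a n <_) (sym (b≡a+2+n n)) (m<m+n (a n) z<s)

  2≤b : ∀ n → 2 ≤ b n
  2≤b n = ≤-trans (2≤a n) (<⇒≤ (a<b n))

  a≢b : ∀ m n → a m ≢ b n
  a≢b m n am≡bn with <-cmp m n
  ... | tri< m<n _ _       = <⇒≢ (<-trans (a-strictMono m<n) (a<b n)) am≡bn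
  ... | tri≈ _ refl _      = <⇒≢ (a<b n) am≡bn
  ... | tri> _ _ (s≤s n≤m) = proj₁ (a-mex _) (inj₁ (n , s≤s n≤m , inj₂ am≡bn))

  cover : ∀ k → ∃[ n ] (2 + k ≡ a n ⊎ 2 + k ≡ b n)
  cover k with proj₂ (a-mex k) (2 + k) (≤-<-trans 2+k≤a (a-step k))
    where
    2+k≤a : 2 + k ≤ a k
    2+k≤a = subst (λ c → c + k ≤ a k) (proj₁ seq) (step⇒f0+n≤fn a-step k)
  ... | inj₁ (n , _ , e) = n , e
  ... | inj₂ (inj₁ ())
  ... | inj₂ (inj₂ ())

module Wythoff {a b : ℕ → ℕ} (seq : IsSeq a b) where
  open Sequence seq

  IsPair : Pos → Set
  IsPair (x , y) = ∃[ n ] ((x ≡ a n × y ≡ b n) ⊎ (x ≡ b n × y ≡ a n))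

  PSet : Pos → Set
  PSet p = Terminal 1 p ⊎ IsPair p

  IsPair-swap : ∀ {p} → IsPair p → IsPair (swap p)
  IsPair-swap (n , pair) = n , Sum.swap (Sum.map swap swap pair)

  PSet-swap : ∀ {p} → PSet p → PSet (swap p)
  PSet-swap {p} = Sum.map (Terminal-swap p) IsPair-swap

  IsPair⇒¬Terminal : ∀ {p} → IsPair p → ¬ Terminal 1 p
  IsPair⇒¬Terminal (n , inj₁ (refl , refl)) = <⇒¬Terminal (a n) (2≤b n)
  IsPair⇒¬Terminal (n , inj₂ (refl , refl)) = <⇒¬Terminal (b n) (2≤a n)

  diag-stable : ∀ n {u} i → a n ≡ u + suc i → ¬ PSet (u , u + (2 + n))
  diag-stable n {u} i _ (inj₁ t) = <⇒¬Terminal u (≤-trans (m≤m+n 2 n) (m≤n+m (2 + n) u)) t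
  diag-stable n {u} i an≡u+i (inj₂ (m , inj₁ (u≡am , v≡bm)))
    with +-cancelˡ-≡ 2 m n (+-cancelˡ-≡ u _ _
           (trans (cong (_+ (2 + m)) u≡am) (trans (sym (b≡a+2+n m)) (sym v≡bm))))
  ... | refl = m+1+n≢m (a n) (sym (trans an≡u+i (cong (_+ suc i) u≡am)))
  diag-stable n {u} i _ (inj₂ (m , inj₂ (u≡bm , v≡am))) =
    <⇒≱ (a<b m) (subst₂ _≤_ u≡bm v≡am (m≤m+n u (2 + n)))

  pair-stable : ∀ n {q} → WStep (a n , b n) q → ¬ PSet q
  pair-stable n (left {u = u} i _) (inj₁ t) = <⇒¬Terminal u (2≤b n) t
  pair-stable n (left i an≡u+i) (inj₂ (m , inj₁ (u≡am , bn≡bm))) with b-injective bn≡bm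
  ... | refl = m+1+n≢m (a n) (sym (trans an≡u+i (cong (_+ suc i) u≡am)))
  pair-stable n (left i _) (inj₂ (m , inj₂ (_ , bn≡am))) = a≢b m n (sym bn≡am)
  pair-stable n (down {v = v} i _) (inj₁ t) = <⇒¬Terminal v (2≤a n) (Terminal-swap (a n , v) t)
  pair-stable n (down i bn≡v+i) (inj₂ (m , inj₁ (an≡am , v≡bm))) with a-injective an≡am
  ... | refl = m+1+n≢m (b n) (sym (trans bn≡v+i (cong (_+ suc i) v≡bm)))
  pair-stable n (down i _) (inj₂ (m , inj₂ (an≡bm , _))) = a≢b n m an≡bm
  pair-stable n (diag i an≡u+i bn≡v+i)
    with diagonal-gap (suc i) (2 + n) an≡u+i bn≡v+i (b≡a+2+n n)
  ... | refl = diag-stable n i an≡u+i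

  PSet-stable : ∀ {p q} → PSet p → Move 1 p q → ¬ PSet q
  PSet-stable (inj₁ t) (nt , _) = contradiction t nt
  PSet-stable {_ , _} (inj₂ (n , inj₁ (refl , refl))) (_ , p→q) =
    pair-stable n (WMove⇒WStep p→q)
  PSet-stable {_ , _} (inj₂ (n , inj₂ (refl , refl))) (_ , p→q) =
    pair-stable n (WStep-swap (WMove⇒WStep p→q)) ∘ PSet-swap

  Absorbed : Pos → Set
  Absorbed p = IsPair p ⊎ ∃[ q ] (WStep p q × PSet q)

  Absorbed-swap : ∀ {p} → Absorbed p → Absorbed (swap p)
  Absorbed-swap = Sum.map IsPair-swap (λ (q , p→q , kq) → swap q , WStep-swap p→q , PSet-swap kq)

  escape-row : ∀ m n {x} → x ≡ a n ⊎ x ≡ b n → Absorbed (x , x + (2 + m))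
  escape-row m n (inj₂ refl) =
    inj₂ (_ , down< (<-≤-trans (a<b n) (m≤m+n (b n) (2 + m))) , inj₂ (n , inj₂ (refl , refl)))
  escape-row m n (inj₁ refl) with <-cmp m n
  ... | tri< m<n _ _ = let i , an≡am+i = <⇒∃+suc (a-strictMono m<n) in
    inj₂ (_ , diag i an≡am+i (y≡bm+i i an≡am+i) , inj₂ (m , inj₁ (refl , refl)))
    where
    y≡bm+i : ∀ i → a n ≡ a m + suc i → a n + (2 + m) ≡ b m + suc i
    y≡bm+i i an≡am+i = trans (cong (_+ (2 + m)) an≡am+i)
      (trans (xy∙z≈xz∙y (a m) (suc i) (2 + m)) (cong (_+ suc i) (sym (b≡a+2+n m))))
  ... | tri≈ _ refl _ = inj₁ (n , inj₁ (refl , sym (b≡a+2+n n)))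
  ... | tri> _ _ n<m = inj₂ (_ , down< bn<y , inj₂ (n , inj₁ (refl , refl)))
    where
    bn<y : b n < a n + (2 + m)
    bn<y = subst (_< a n + (2 + m)) (sym (b≡a+2+n n)) (+-monoʳ-< (a n) (+-monoʳ-< 2 n<m))

  escape≤ : ∀ x d → ¬ Terminal 1 (x , x + d) → Absorbed (x , x + d)
  escape≤ 0 0 nt = contradiction z≤n nt
  escape≤ 0 1 nt = contradiction ≤-refl nt
  escape≤ 0 (suc (suc d)) _ = inj₂ ((0 , 0) , down (suc d) refl , inj₁ z≤n)
  escape≤ (suc x) 0 _ = inj₂ ((0 , 0) , diag x refl (+-identityʳ (suc x)) , inj₁ z≤n)
  escape≤ (suc x) 1 _ = inj₂ ((0 , 1) , diag x refl (+-comm (suc x) 1) , inj₁ ≤-refl)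
  escape≤ 1 (suc (suc d)) _ = inj₂ ((1 , 0) , down (suc (suc d)) refl , inj₁ ≤-refl)
  escape≤ (suc (suc x)) (suc (suc m)) _ = let n , x∈row = cover x in escape-row m n x∈row

  escape : ∀ x y → ¬ Terminal 1 (x , y) → Absorbed (x , y)
  escape x y nt with ≤-total x y
  ... | inj₁ x≤y with m≤n⇒∃[o]m+o≡n x≤y
  ...   | d , refl = escape≤ x d nt
  escape x y nt | inj₂ y≤x with m≤n⇒∃[o]m+o≡n y≤x
  ...   | d , refl = Absorbed-swap (escape≤ y d (nt ∘ Terminal-swap (y , y + d)))

  PSet-absorbing : ∀ p → PSet p ⊎ ∃[ q ] (Move 1 p q × PSet q)
  PSet-absorbing (x , y) with x + y ≤? 1
  ... | yes t  = inj₁ (inj₁ t)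
  ... | no nt = Sum.map inj₂ (λ (q , p→q , kq) → q , (nt , WStep⇒WMove p→q) , kq) (escape x y nt)

proposition15 : (a b : ℕ → ℕ) → IsSeq a b → (x y : ℕ) →
    (IsP 1 (x , y) × ¬ Terminal 1 (x , y))
      ⇔ (∃[ n ] ((x ≡ a n × y ≡ b n) ⊎ (x ≡ b n × y ≡ a n)))
proposition15 a b seq x y = mk⇔
  (λ (isp , nt) → [ (λ t → contradiction t nt) , id ]′ (IsP⇒kernel PSet-stable PSet-absorbing isp))
  (λ pair → kernel⇒IsP PSet-stable PSet-absorbing (inj₂ pair) , IsPair⇒¬Terminal pair)
  where open Wythoff seq
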